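{- Let $G$ be a simple connected plane graph and let $D=m(G)$ be its medial graph. Then $D$ is a tight lune-free link graph if and only if $G$ is special.
   Context: The medial graph $m(G)$ of a plane graph $G$ is the $4$-regular plane graph whose vertices correspond to the edges of $G$, with an edge joining two of them for each pair of edges of $G$ that are consecutive on the boundary of a common face of $G$. A link graph is a connected $4$-regular plane graph; it is lune-free if it has no loops and no multiple edges, and tight if for every pair of adjacent faces (sharing an edge) at least one of them has exactly $3$ edges on its boundary. The degree of a face of $G$ is the number of edges of $G$ incident to it. A connected plane graph $G$ is special if (1) all vertices and all faces of $G$ have degree $\ge 3$, and (2) whenever a vertex $x$ is incident with a face $F$, either $\deg(x)=3$ or $\deg(F)=3$. -}

module Defs where

-- Plane graphs are represented by combinatorial maps (rotation systems):
-- a finite set of darts (half-edges) Fin n, a fixed-point-free involution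
-- α (the two darts of an edge), and a permutation σ (cyclic rotation of
-- darts around their vertex).  Vertices = σ-orbits, edges = α-orbits,
-- faces = φ-orbits where φ = σ ∘ α.  Planarity = Euler's formula
-- V - E + F = 2 (genus 0) for a connected map.

open import Data.Nat using (ℕ; zero; suc; _+_; _≤_; _<_; _≤ᵇ_; _≡ᵇ_)
open import Data.Bool using (Bool; true; false; _∨_; _∧_; not)
open import Data.Fin using (Fin; toℕ; _↑ˡ_; _↑ʳ_; splitAt)
open import Data.List using (List; length; filterᵇ; allFin; upTo)
open import Data.Bool.ListAction using (any; all)
open import Data.Product using (Σ; _×_; ∃-syntax; _,_)
open import Data.Sum using (_⊎_; inj₁; inj₂)
open import Relation.Binary.PropositionalEquality using (_≡_; _≢_)
open import Relation.Binary.Construct.Closure.ReflexiveTransitive using (Star)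
open import Relation.Nullary using (¬_)

iter : {A : Set} → (A → A) → ℕ → A → A
iter f zero    x = x
iter f (suc k) x = f (iter f k x)

record PreMap : Set where
  field
    n   : ℕ
    α   : Fin n → Fin n
    σ   : Fin n → Fin n
    σ⁻  : Fin n → Fin n
  φ : Fin n → Fin n
  φ x = σ (α x)

module _ (M : PreMap) where
  open PreMap M

  record IsMap : Set where
    field
      α-invol   : ∀ x → α (α x) ≡ x
      α-fpf     : ∀ x → α x ≢ x
      σ-σ⁻      : ∀ x → σ (σ⁻ x) ≡ x
      σ⁻-σ      : ∀ x → σ⁻ (σ x) ≡ x

  _≡F_ : Fin n → Fin n → Bool
  x ≡F y = toℕ x ≡ᵇ toℕ y

  -- y lies in the orbit of x under f  (orbits of permutations of Fin n
  -- have size ≤ n, so exponents k < n suffice)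
  inOrbitᵇ : (Fin n → Fin n) → Fin n → Fin n → Bool
  inOrbitᵇ f x y = any (λ k → iter f k x ≡F y) (upTo n)

  count : (Fin n → Bool) → ℕ
  count p = length (filterᵇ p (allFin n))

  orbitSize : (Fin n → Fin n) → Fin n → ℕ
  orbitSize f x = count (inOrbitᵇ f x)

  -- number of orbits of f: count the darts that are minimal in their orbit
  numOrbits : (Fin n → Fin n) → ℕ
  numOrbits f = count (λ x → all (λ k → toℕ x ≤ᵇ toℕ (iter f k x)) (upTo n))

  SameVertex : Fin n → Fin n → Set
  SameVertex x y = ∃[ k ] (iter σ k x ≡ y)

  SameFace : Fin n → Fin n → Set
  SameFace x y = ∃[ k ] (iter φ k x ≡ y)

  vertexDeg : Fin n → ℕ
  vertexDeg x = orbitSize σ x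

  -- degree of the face of dart x: the number of (distinct) edges incident
  -- to it; each edge {y , α y} is counted via its dart of smaller index
  faceDeg : Fin n → ℕ
  faceDeg x = count (λ y → (inOrbitᵇ φ x y ∨ inOrbitᵇ φ x (α y))
                           ∧ (toℕ y ≤ᵇ toℕ (α y)))

  Connected : Set
  Connected = ∀ x y → Star (λ u v → (v ≡ α u) ⊎ (v ≡ σ u)) x y

  Planar : Set
  Planar = numOrbits σ + numOrbits φ ≡ 2 + numOrbits α

  IsConnectedPlaneGraph : Set
  IsConnectedPlaneGraph = IsMap × Connected × Planar

  NoLoops : Set
  NoLoops = ∀ x → ¬ SameVertex x (α x)

  NoMultipleEdges : Set
  NoMultipleEdges = ∀ x y → SameVertex x y → SameVertex (α x) (α y)
                          → (x ≡ y) ⊎ (x ≡ α y)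

  IsSimple : Set
  IsSimple = NoLoops × NoMultipleEdges

  IsLinkGraph : Set
  IsLinkGraph = IsConnectedPlaneGraph × (∀ x → vertexDeg x ≡ 4)

  IsLuneFree : Set
  IsLuneFree = IsSimple

  IsTight : Set
  IsTight = ∀ x → (faceDeg x ≡ 3) ⊎ (faceDeg (α x) ≡ 3)

  IsSpecial : Set
  IsSpecial = Connected
            × (∀ x → 3 ≤ vertexDeg x)
            × (∀ x → 3 ≤ faceDeg x)
            × (∀ x y → (∃[ z ] (SameVertex x z × SameFace y z))
                     → (vertexDeg x ≡ 3) ⊎ (faceDeg y ≡ 3))

-- Dart (d , true)  ↦ d ↑ˡ n ,  (d , false) ↦ n ↑ʳ d.
-- (d , true) is the half-edge at the midpoint of the edge of d heading to
-- the corner (d , σ d);  (d , false) heads to the corner (σ⁻ d , d).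
-- Medial edges are the corners of G:  α'(d,true) = (σ d,false),
-- α'(d,false) = (σ⁻ d,true).  Rotation at the midpoint of an edge:
-- σ'(d,true) = (d,false),  σ'(d,false) = (α d,true).
medial : PreMap → PreMap
medial M = record { n = n + n ; α = α' ; σ = σ' ; σ⁻ = σ'⁻ }
  where
    open PreMap M
    T F : Fin n → Fin (n + n)
    T d = d ↑ˡ n
    F d = n ↑ʳ d
    α' σ' σ'⁻ : Fin (n + n) → Fin (n + n)
    α' y with splitAt n y
    ... | inj₁ d = F (σ d)
    ... | inj₂ d = T (σ⁻ d)
    σ' y with splitAt n y
    ... | inj₁ d = F d
    ... | inj₂ d = T (α d)
    σ'⁻ y with splitAt n y
    ... | inj₁ d = F (α d)
    ... | inj₂ d = T d

{-# OPTIONS --safe #-}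
module Submission where

-- Write fwd d and bwd d for the two darts of the medial map M lying on the edge of G through
-- the dart d.  The medial vertex on the edge {d , α d} consists of fwd d, bwd d, fwd (α d) and
-- bwd (α d), so M is 4-regular.  The face permutation of M sends fwd d to fwd (α (σ d)) and
-- bwd d to bwd (σ⁻ d): the faces of M through bwd darts are the vertices of G, and those
-- through fwd darts are the faces of G, since α ∘ σ is conjugate to φ = σ ∘ α by σ.  The medial
-- edge from fwd c to bwd (σ c) separates the medial face of the face of G at σ c from the
-- medial face of the vertex of σ c, so M is tight exactly when every corner of G lies at a
-- vertex of degree 3 or on a face whose orbit under φ is a triangle; for a simple G the latter
-- means that the face has degree 3.  For a simple G, a loop of M comes from a vertex of degree 1
-- and a double edge from a vertex of degree 2, and once every vertex has degree at least 2 the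
-- first three darts of a face lie on three distinct edges.  Euler's formula passes to M since
-- M has E vertices, 2E edges and F + V faces.

open import Defs
open import Data.Bool using (Bool; true; false; not; _∧_; _∨_; T)
open import Data.Bool.ListAction using (all)
open import Data.Bool.Properties using (T-∧; T-∨)
open import Data.Empty using (⊥-elim)
open import Data.Fin using (Fin; zero; suc; toℕ; _↑ˡ_; _↑ʳ_; splitAt)
import Data.Fin.Properties as Fin
open import Data.List using (List; []; _∷_; length; map; tabulate; filterᵇ; upTo; applyUpTo)
open import Data.List.Properties using (length-map; length-applyUpTo)
open import Data.List.Extrema.Nat using (argmin; argmin-all; f[argmin]≤f[xs])
open import Data.List.Membership.Propositional using (_∈_; _∉_)
open import Data.List.Membership.Propositional.Properties using (∈-map⁺; ∈-applyUpTo⁺)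
open import Data.List.Relation.Unary.All as All using (All; []; _∷_)
import Data.List.Relation.Unary.All.Properties as All
open import Data.List.Relation.Unary.AllPairs as AllPairs using (AllPairs; []; _∷_)
import Data.List.Relation.Unary.AllPairs.Properties as AllPairs
open import Data.List.Relation.Unary.Any using (here; there)
import Data.List.Relation.Unary.Any.Properties as Any
open import Data.Nat using (ℕ; zero; suc; _+_; _*_; _≤_; _<_; _≤ᵇ_; _≡ᵇ_; _≤?_; z≤n; s≤s)
open import Data.Nat.DivMod using (_%_; _/_; m≡m%n+[m/n]*n; m%n<n)
open import Data.Nat.Properties
open import Data.Product using (∃-syntax; _×_; _,_; proj₁; proj₂)
open import Data.Sum as Sum using (_⊎_; inj₁; inj₂)
open import Function using (_∘_; id; _⇔_; mk⇔; Equivalence)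
import Function.Properties.Equivalence as ⇔
open import Relation.Binary.Construct.Closure.ReflexiveTransitive using (Star; ε; _◅_; _◅◅_; kleisliStar)
open import Relation.Binary.PropositionalEquality
open import Relation.Nullary using (¬_; does; yes; no)

iter-+ : ∀ {A : Set} (f : A → A) m n x → iter f (m + n) x ≡ iter f m (iter f n x)
iter-+ f zero    n x = refl
iter-+ f (suc m) n x = cong f (iter-+ f m n x)

iter-commute : ∀ {A B : Set} {f : A → A} {g : B → B} (h : A → B) →
               (∀ x → g (h x) ≡ h (f x)) → ∀ k x → iter g k (h x) ≡ h (iter f k x)
iter-commute         h comm zero    x = refl
iter-commute {g = g} h comm (suc k) x = trans (cong g (iter-commute h comm k x)) (comm _)

iter-cancel : ∀ {A : Set} {f g : A → A} → (∀ x → g (f x) ≡ x) →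
              ∀ k x → iter g k (iter f k x) ≡ x
iter-cancel             g∘f zero    x = refl
iter-cancel {f = f} {g} g∘f (suc k) x = begin
  g (iter g k (f (iter f k x)))  ≡⟨ iter-commute g (λ _ → refl) k _ ⟨
  iter g k (g (f (iter f k x)))  ≡⟨ cong (iter g k) (g∘f _) ⟩
  iter g k (iter f k x)          ≡⟨ iter-cancel g∘f k x ⟩
  x                              ∎
  where open ≡-Reasoning

T-injective : ∀ {a b : Bool} → (T a → T b) → (T b → T a) → a ≡ b
T-injective {false} {false} _   _   = refl
T-injective {false} {true}  _   b⇒a = ⊥-elim (b⇒a _)
T-injective {true}  {false} a⇒b _   = ⊥-elim (a⇒b _)
T-injective {true}  {true}  _   _   = refl

countFin : ∀ {N} → (Fin N → Bool) → ℕ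
countFin {zero}  p = 0
countFin {suc N} p with p zero
... | true  = suc (countFin (p ∘ suc))
... | false = countFin (p ∘ suc)

length-filterᵇ-tabulate : ∀ {A : Set} {N} (f : Fin N → A) (p : A → Bool) →
                          length (filterᵇ p (tabulate f)) ≡ countFin (p ∘ f)
length-filterᵇ-tabulate {N = zero}  f p = refl
length-filterᵇ-tabulate {N = suc N} f p with p (f zero)
... | true  = cong suc (length-filterᵇ-tabulate (f ∘ suc) p)
... | false = length-filterᵇ-tabulate (f ∘ suc) p

count≡countFin : ∀ (M : PreMap) p → count M p ≡ countFin p
count≡countFin M p = length-filterᵇ-tabulate id p

countFin-congʷ : ∀ {N} {p q : Fin N → Bool} → (∀ x → p x ≡ q x) → countFin p ≡ countFin q
countFin-congʷ {zero}          p≗q = refl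
countFin-congʷ {suc N} {p} {q} p≗q rewrite p≗q zero with q zero
... | true  = cong suc (countFin-congʷ (p≗q ∘ suc))
... | false = countFin-congʷ (p≗q ∘ suc)

countFin-cong : ∀ {N} {p q : Fin N → Bool} → (∀ x → T (p x) → T (q x)) → (∀ x → T (q x) → T (p x)) →
                countFin p ≡ countFin q
countFin-cong p⇒q q⇒p = countFin-congʷ (λ x → T-injective (p⇒q x) (q⇒p x))

countFin-false : ∀ {N} {p : Fin N → Bool} → (∀ x → ¬ T (p x)) → countFin p ≡ 0
countFin-false {zero}      ¬p = refl
countFin-false {suc N} {p} ¬p with p zero | ¬p zero
... | true  | ¬p₀ = ⊥-elim (¬p₀ _)
... | false | _   = countFin-false (¬p ∘ suc)

countFin-true : ∀ {N} {p : Fin N → Bool} → (∀ x → T (p x)) → countFin p ≡ N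
countFin-true {zero}      ok = refl
countFin-true {suc N} {p} ok with p zero | ok zero
... | true | _ = cong suc (countFin-true (ok ∘ suc))

countFin-↑ : ∀ m {k} (p : Fin (m + k) → Bool) →
             countFin p ≡ countFin (p ∘ (_↑ˡ k)) + countFin (p ∘ (m ↑ʳ_))
countFin-↑ zero    p = refl
countFin-↑ (suc m) p with p zero
... | true  = cong suc (countFin-↑ m (p ∘ suc))
... | false = countFin-↑ m (p ∘ suc)

countFin-+-not : ∀ {N} (p : Fin N → Bool) → countFin p + countFin (not ∘ p) ≡ N
countFin-+-not {zero}  p = refl
countFin-+-not {suc N} p with p zero
... | true  = cong suc (countFin-+-not (p ∘ suc))
... | false = trans (+-suc _ _) (cong suc (countFin-+-not (p ∘ suc)))

private
  delete : ∀ {N} → Fin N → (Fin N → Bool) → Fin N → Bool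
  delete y q z = not (does (z Fin.≟ y)) ∧ q z

  delete⇒ : ∀ {N} (y : Fin N) (q : Fin N → Bool) z → T (delete y q z) → z ≢ y × T (q z)
  delete⇒ y q z t with z Fin.≟ y
  ... | yes _   = ⊥-elim t
  ... | no  z≢y = z≢y , t

  ⇒delete : ∀ {N} (y : Fin N) (q : Fin N → Bool) {z} → z ≢ y → T (q z) → T (delete y q z)
  ⇒delete y q {z} z≢y qz with z Fin.≟ y
  ... | yes z≡y = ⊥-elim (z≢y z≡y)
  ... | no  _   = qz

  countFin-delete : ∀ {N} (q : Fin N → Bool) y → T (q y) → countFin q ≡ suc (countFin (delete y q))
  countFin-delete q zero    qy with q zero
  ... | true = refl
  countFin-delete q (suc y) qy with q zero
  ... | true  = cong suc (countFin-delete (q ∘ suc) y qy)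
  ... | false = countFin-delete (q ∘ suc) y qy

  countFin-≤-delete : ∀ {N} (q : Fin N → Bool) y → countFin q ≤ suc (countFin (delete y q))
  countFin-≤-delete q y with q y in qy
  ... | true  = ≤-reflexive (countFin-delete q y (subst T (sym qy) _))
  ... | false = m≤n⇒m≤1+n (≤-reflexive
                  (countFin-cong (λ z qz → ⇒delete y q (z≢y z qz) qz) (λ z → proj₂ ∘ delete⇒ y q z)))
    where
      z≢y : ∀ z → T (q z) → z ≢ y
      z≢y z qz refl = subst T qy qz

countFin-≤-length : ∀ {N} {p : Fin N → Bool} (l : List (Fin N)) → (∀ x → T (p x) → x ∈ l) →
                    countFin p ≤ length l
countFin-≤-length         []      p⊆l = ≤-reflexive (countFin-false (λ x → ∉[] ∘ p⊆l x))
  where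
    ∉[] : ∀ {x : Fin _} → x ∉ []
    ∉[] ()
countFin-≤-length {p = p} (y ∷ l) p⊆l =
  ≤-trans (countFin-≤-delete p y) (s≤s (countFin-≤-length l p-y⊆l))
  where
    p-y⊆l : ∀ x → T (delete y p x) → x ∈ l
    p-y⊆l x t with x≢y , px ← delete⇒ y p x t with p⊆l x px
    ... | here  x≡y = ⊥-elim (x≢y x≡y)
    ... | there x∈l = x∈l

length-≤-countFin : ∀ {N} {p : Fin N → Bool} (l : List (Fin N)) → AllPairs _≢_ l → All (T ∘ p) l →
                    length l ≤ countFin p
length-≤-countFin         []      _                _         = z≤n
length-≤-countFin {p = p} (y ∷ l) (y≢l ∷ distinct) (py ∷ pl) = ≤-trans
  (s≤s (length-≤-countFin l distinct (All.zipWith (λ (y≢x , px) → ⇒delete y p (y≢x ∘ sym) px) (y≢l , pl))))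
  (≤-reflexive (sym (countFin-delete p y py)))

countFin-≤-injective : ∀ {N N′} {p : Fin N → Bool} {q : Fin N′ → Bool} (h : Fin N → Fin N′) →
                       (∀ x → T (p x) → T (q (h x))) →
                       (∀ {x y} → T (p x) → T (p y) → h x ≡ h y → x ≡ y) →
                       countFin p ≤ countFin q
countFin-≤-injective {zero}              h p⇒qh inj = z≤n
countFin-≤-injective {suc N} {p = p} {q} h p⇒qh inj with p zero in p₀
... | false = countFin-≤-injective (h ∘ suc) (p⇒qh ∘ suc) (λ px py → Fin.suc-injective ∘ inj px py)
... | true  = ≤-trans
  (s≤s (countFin-≤-injective (h ∘ suc) p⇒q-h₀ (λ px py → Fin.suc-injective ∘ inj px py)))
  (≤-reflexive (sym (countFin-delete q (h zero) (p⇒qh zero p-zero))))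
  where
    p-zero : T (p zero)
    p-zero = subst T (sym p₀) _

    p⇒q-h₀ : ∀ x → T (p (suc x)) → T (delete (h zero) q (h (suc x)))
    p⇒q-h₀ x px = ⇒delete (h zero) q (suc≢zero ∘ inj px p-zero) (p⇒qh (suc x) px)
      where
        suc≢zero : suc x ≢ zero
        suc≢zero ()

countFin-∘-involution : ∀ {N} (p : Fin N → Bool) (h : Fin N → Fin N) → (∀ x → h (h x) ≡ x) →
                        countFin (p ∘ h) ≡ countFin p
countFin-∘-involution p h h∘h = ≤-antisym
  (countFin-≤-injective h (λ _ phx → phx) (λ _ _ → h-injective))
  (countFin-≤-injective h (λ x px → subst (T ∘ p) (sym (h∘h x)) px) (λ _ _ → h-injective))
  where
    h-injective : ∀ {x y} → h x ≡ h y → x ≡ y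
    h-injective {x} {y} e = trans (sym (h∘h x)) (trans (cong h e) (h∘h y))

IsLeastInOrbit : ∀ {N} → (Fin N → Fin N) → Fin N → Set
IsLeastInOrbit f x = ∀ k → toℕ x ≤ toℕ (iter f k x)

IsLeastInOrbit-involution : ∀ {N} {f : Fin N → Fin N} → (∀ y → f (f y) ≡ y) →
                            ∀ {x} → toℕ x ≤ toℕ (f x) → IsLeastInOrbit f x
IsLeastInOrbit-involution f∘f x≤fx zero       = ≤-refl
IsLeastInOrbit-involution f∘f x≤fx (suc zero) = x≤fx
IsLeastInOrbit-involution {f = f} f∘f {x} x≤fx (suc (suc k))
  rewrite f∘f (iter f k x) = IsLeastInOrbit-involution f∘f x≤fx k

IsLeastInOrbit-shift : ∀ {N N′} {f : Fin N → Fin N} {g : Fin N′ → Fin N′} (h : Fin N → Fin N′) c →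
                       (∀ x → toℕ (h x) ≡ c + toℕ x) → (∀ x → g (h x) ≡ h (f x)) →
                       ∀ {x} → IsLeastInOrbit g (h x) ⇔ IsLeastInOrbit f x
IsLeastInOrbit-shift {f = f} {g} h c toℕ-h comm {x} = mk⇔
  (λ least k → +-cancelˡ-≤ c _ _ (subst₂ _≤_ (toℕ-h x) (toℕ-iter k) (least k)))
  (λ least k → subst₂ _≤_ (sym (toℕ-h x)) (sym (toℕ-iter k)) (+-monoʳ-≤ c (least k)))
  where
    toℕ-iter : ∀ k → toℕ (iter g k (h x)) ≡ c + toℕ (iter f k x)
    toℕ-iter k = trans (cong toℕ (iter-commute h comm k x)) (toℕ-h _)

IsLeastInOrbit-⊆ : ∀ {N} {f g : Fin N → Fin N} {x} → (∀ k → ∃[ j ] iter f j x ≡ iter g k x) →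
                   IsLeastInOrbit f x → IsLeastInOrbit g x
IsLeastInOrbit-⊆ {x = x} g⊆f least k with j , fʲx≡gᵏx ← g⊆f k =
  subst (λ z → toℕ x ≤ toℕ z) fʲx≡gᵏx (least j)

¬IsLeastInOrbit : ∀ {N} {f : Fin N → Fin N} {x} → toℕ (f x) < toℕ x → ¬ IsLeastInOrbit f x
¬IsLeastInOrbit fx<x least = <⇒≱ fx<x (least 1)

module Orbit (M : PreMap) (f f⁻ : Fin (PreMap.n M) → Fin (PreMap.n M))
             (f⁻∘f : ∀ x → f⁻ (f x) ≡ x) where
  open PreMap M using (n)

  f-injective : ∀ {x y} → f x ≡ f y → x ≡ y
  f-injective {x} {y} e = trans (sym (f⁻∘f x)) (trans (cong f⁻ e) (f⁻∘f y))

  iter-injective : ∀ k {x y} → iter f k x ≡ iter f k y → x ≡ y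
  iter-injective zero    e = e
  iter-injective (suc k) e = iter-injective k (f-injective e)

  period : ∀ x → ∃[ p ] suc p ≤ n × iter f (suc p) x ≡ x
  period x
    with i , j , i<j , fⁱx≡fʲx ← Fin.pigeonhole (n<1+n n) (λ (i : Fin (suc n)) → iter f (toℕ i) x)
    with p , i+p≡j ← m≤n⇒∃[o]m+o≡n i<j
    = p , ≤-trans (s≤s (m≤n+m p (toℕ i))) (≤-trans (≤-reflexive i+p≡j) (Fin.toℕ≤pred[n] j))
        , sym (iter-injective (toℕ i) (begin
            iter f (toℕ i) x                   ≡⟨ fⁱx≡fʲx ⟩
            iter f (toℕ j) x                   ≡⟨ cong (λ k → iter f k x) j≡i+[1+p] ⟩
            iter f (toℕ i + suc p) x           ≡⟨ iter-+ f (toℕ i) (suc p) x ⟩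
            iter f (toℕ i) (iter f (suc p) x)  ∎))
    where
      open ≡-Reasoning
      j≡i+[1+p] : toℕ j ≡ toℕ i + suc p
      j≡i+[1+p] = trans (sym i+p≡j) (sym (+-suc (toℕ i) p))

  iter-*-period : ∀ {p x} → iter f p x ≡ x → ∀ q → iter f (q * p) x ≡ x
  iter-*-period         fᵖx≡x zero    = refl
  iter-*-period {p} {x} fᵖx≡x (suc q) =
    trans (iter-+ f p (q * p) x) (trans (cong (iter f p) (iter-*-period fᵖx≡x q)) fᵖx≡x)

  iter-%-period : ∀ {p x} → iter f (suc p) x ≡ x → ∀ k → iter f (k % suc p) x ≡ iter f k x
  iter-%-period {p} {x} fᵖ⁺¹x≡x k = sym (begin
    iter f k x                                  ≡⟨ cong (λ j → iter f j x) (m≡m%n+[m/n]*n k (suc p)) ⟩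
    iter f (k % suc p + q * suc p) x            ≡⟨ iter-+ f (k % suc p) (q * suc p) x ⟩
    iter f (k % suc p) (iter f (q * suc p) x)   ≡⟨ cong (iter f (k % suc p)) (iter-*-period fᵖ⁺¹x≡x q) ⟩
    iter f (k % suc p) x                        ∎)
    where
      open ≡-Reasoning
      q : ℕ
      q = k / suc p

  iter-< : ∀ k x → ∃[ j ] j < n × iter f j x ≡ iter f k x
  iter-< k x with p , p<n , fᵖ⁺¹x≡x ← period x =
    k % suc p , <-≤-trans (m%n<n k (suc p)) p<n , iter-%-period fᵖ⁺¹x≡x k

  InOrbit : Fin n → Fin n → Set
  InOrbit x y = ∃[ k ] iter f k x ≡ y

  InOrbit-refl : ∀ {x} → InOrbit x x
  InOrbit-refl = 0 , refl

  InOrbit-trans : ∀ {x y z} → InOrbit x y → InOrbit y z → InOrbit x z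
  InOrbit-trans {x} (k , refl) (j , refl) = j + k , iter-+ f j k x

  InOrbit-sym : ∀ {x y} → InOrbit x y → InOrbit y x
  InOrbit-sym {x} (k , refl) with p , _ , fᵖ⁺¹x≡x ← period x = k * p , (begin
    iter f (k * p) (iter f k x)  ≡⟨ iter-+ f (k * p) k x ⟨
    iter f (k * p + k) x         ≡⟨ cong (λ j → iter f j x) (trans (+-comm (k * p) k) (sym (*-suc k p))) ⟩
    iter f (k * suc p) x         ≡⟨ iter-*-period fᵖ⁺¹x≡x k ⟩
    x                            ∎)
    where open ≡-Reasoning

  InOrbit-periodic : ∀ {p x y} → iter f (suc p) x ≡ x → InOrbit x y →
                     y ∈ applyUpTo (λ k → iter f k x) (suc p)
  InOrbit-periodic {p} {x} fᵖ⁺¹x≡x (k , refl) =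
    subst (_∈ _) (iter-%-period fᵖ⁺¹x≡x k) (∈-applyUpTo⁺ (λ j → iter f j x) (m%n<n k (suc p)))

  inOrbitᵇ⇒InOrbit : ∀ x y → T (inOrbitᵇ M f x y) → InOrbit x y
  inOrbitᵇ⇒InOrbit x y t
    with k , _ , e ← Any.applyUpTo⁻ id (Any.any⁻ (λ k → toℕ (iter f k x) ≡ᵇ toℕ y) (upTo n) t)
    = k , Fin.toℕ-injective (≡ᵇ⇒≡ _ _ e)

  InOrbit⇒inOrbitᵇ : ∀ {x y} → InOrbit x y → T (inOrbitᵇ M f x y)
  InOrbit⇒inOrbitᵇ {x} (k , refl) with j , j<n , fʲx≡fᵏx ← iter-< k x =
    Any.any⁺ _ (Any.applyUpTo⁺ id (≡⇒≡ᵇ _ _ (cong toℕ fʲx≡fᵏx)) j<n)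

  orbitSize≡countFin : ∀ x → orbitSize M f x ≡ countFin (inOrbitᵇ M f x)
  orbitSize≡countFin x = count≡countFin M (inOrbitᵇ M f x)

  orbitSize-cong : ∀ {x z} → InOrbit x z → orbitSize M f x ≡ orbitSize M f z
  orbitSize-cong {x} {z} x~z = begin
    orbitSize M f x            ≡⟨ orbitSize≡countFin x ⟩
    countFin (inOrbitᵇ M f x)  ≡⟨ countFin-cong
      (λ y t → InOrbit⇒inOrbitᵇ (InOrbit-trans (InOrbit-sym x~z) (inOrbitᵇ⇒InOrbit x y t)))
      (λ y t → InOrbit⇒inOrbitᵇ (InOrbit-trans x~z (inOrbitᵇ⇒InOrbit z y t))) ⟩
    countFin (inOrbitᵇ M f z)  ≡⟨ orbitSize≡countFin z ⟨
    orbitSize M f z            ∎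
    where open ≡-Reasoning

  orbitSize-≤-length : ∀ {x} (ys : List (Fin n)) → (∀ {y} → InOrbit x y → y ∈ ys) →
                       orbitSize M f x ≤ length ys
  orbitSize-≤-length {x} ys orbit⊆ys = ≤-trans (≤-reflexive (orbitSize≡countFin x))
    (countFin-≤-length ys (λ y → orbit⊆ys ∘ inOrbitᵇ⇒InOrbit x y))

  orbitSize-≤-period : ∀ {p x} → iter f (suc p) x ≡ x → orbitSize M f x ≤ suc p
  orbitSize-≤-period {p} {x} fᵖ⁺¹x≡x =
    ≤-trans (orbitSize-≤-length (applyUpTo (λ k → iter f k x) (suc p)) (InOrbit-periodic fᵖ⁺¹x≡x))
            (≤-reflexive (length-applyUpTo (λ k → iter f k x) (suc p)))

  length-≤-orbitSize : ∀ {x} (ys : List (Fin n)) → AllPairs _≢_ ys → All (InOrbit x) ys →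
                       length ys ≤ orbitSize M f x
  length-≤-orbitSize {x} ys distinct inOrbit = ≤-trans
    (length-≤-countFin ys distinct (All.map InOrbit⇒inOrbitᵇ inOrbit))
    (≤-reflexive (sym (orbitSize≡countFin x)))

  3≤orbitSize⇔ : ∀ {x} → 3 ≤ orbitSize M f x ⇔ (f x ≢ x × f (f x) ≢ x)
  3≤orbitSize⇔ {x} = mk⇔
    (λ 3≤ → (λ fx≡x → 1+n≰n (≤-trans 3≤ (≤-trans (orbitSize-≤-period fx≡x) (s≤s z≤n))))
          , (λ f²x≡x → 1+n≰n (≤-trans 3≤ (orbitSize-≤-period f²x≡x))))
    (λ (fx≢x , f²x≢x) → length-≤-orbitSize (x ∷ f x ∷ f (f x) ∷ [])
       ((≢-sym fx≢x ∷ ≢-sym f²x≢x ∷ []) ∷ (≢-sym fx≢x ∘ f-injective ∷ []) ∷ [] ∷ [])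
       ((0 , refl) ∷ (1 , refl) ∷ (2 , refl) ∷ []))

  IsTriangle : Fin n → Set
  IsTriangle x = f (f (f x)) ≡ x × f x ≢ x

  orbitSize≡3⇔IsTriangle : ∀ {x} → orbitSize M f x ≡ 3 ⇔ IsTriangle x
  orbitSize≡3⇔IsTriangle {x} = mk⇔ triangle size≡3
    where
      triangle : orbitSize M f x ≡ 3 → IsTriangle x
      triangle size≡3
        with fx≢x , f²x≢x ← Equivalence.to 3≤orbitSize⇔ (≤-reflexive (sym size≡3))
        with f (f (f x)) Fin.≟ x
      ... | yes f³x≡x = f³x≡x , fx≢x
      ... | no  f³x≢x = ⊥-elim (1+n≰n (≤-trans 4≤size (≤-reflexive size≡3)))
        where
          4≤size : 4 ≤ orbitSize M f x
          4≤size = length-≤-orbitSize (x ∷ f x ∷ f (f x) ∷ f (f (f x)) ∷ [])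
            ((≢-sym fx≢x ∷ ≢-sym f²x≢x ∷ ≢-sym f³x≢x ∷ [])
             ∷ (≢-sym fx≢x ∘ f-injective ∷ ≢-sym f²x≢x ∘ f-injective ∷ [])
             ∷ (≢-sym fx≢x ∘ f-injective ∘ f-injective ∷ []) ∷ [] ∷ [])
            ((0 , refl) ∷ (1 , refl) ∷ (2 , refl) ∷ (3 , refl) ∷ [])

      size≡3 : IsTriangle x → orbitSize M f x ≡ 3
      size≡3 (f³x≡x , fx≢x) = ≤-antisym (orbitSize-≤-period f³x≡x)
        (Equivalence.from 3≤orbitSize⇔ (fx≢x , λ f²x≡x → fx≢x (trans (sym (cong f f²x≡x)) f³x≡x)))

  isLeastᵇ : Fin n → Bool
  isLeastᵇ x = all (λ k → toℕ x ≤ᵇ toℕ (iter f k x)) (upTo n)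

  numOrbits≡countFin : numOrbits M f ≡ countFin isLeastᵇ
  numOrbits≡countFin = count≡countFin M isLeastᵇ

  isLeastᵇ⇒IsLeast : ∀ x → T (isLeastᵇ x) → IsLeastInOrbit f x
  isLeastᵇ⇒IsLeast x t k with j , j<n , fʲx≡fᵏx ← iter-< k x =
    subst (λ y → toℕ x ≤ toℕ y) fʲx≡fᵏx
      (≤ᵇ⇒≤ _ _ (All.applyUpTo⁻ id n (All.all⁺ (λ k → toℕ x ≤ᵇ toℕ (iter f k x)) (upTo n) t) j<n))

  IsLeast⇒isLeastᵇ : ∀ {x} → IsLeastInOrbit f x → T (isLeastᵇ x)
  IsLeast⇒isLeastᵇ least = All.all⁻ _ (All.applyUpTo⁺₂ id n (λ k → ≤⇒≤ᵇ (least k)))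

  IsLeast-unique : ∀ {x y} → InOrbit x y → IsLeastInOrbit f x → IsLeastInOrbit f y → x ≡ y
  IsLeast-unique x~y@(k , fᵏx≡y) x-least y-least with j , fʲy≡x ← InOrbit-sym x~y =
    Fin.toℕ-injective (≤-antisym (subst (λ z → toℕ _ ≤ toℕ z) fᵏx≡y (x-least k))
                                 (subst (λ z → toℕ _ ≤ toℕ z) fʲy≡x (y-least j)))

  least : Fin n → Fin n
  least y = argmin toℕ y (applyUpTo (λ k → iter f k y) n)

  InOrbit-least : ∀ y → InOrbit y (least y)
  InOrbit-least y =
    argmin-all toℕ {P = InOrbit y} InOrbit-refl (All.applyUpTo⁺₂ (λ k → iter f k y) n (λ k → k , refl))

  least-IsLeast : ∀ y → IsLeastInOrbit f (least y)
  least-IsLeast y k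
    with k′ , fᵏ′y≡fᵏleast ← InOrbit-trans (InOrbit-least y) (k , refl)
    with j , j<n , fʲy≡fᵏ′y ← iter-< k′ y
    = subst (λ z → toℕ (least y) ≤ toℕ z) (trans fʲy≡fᵏ′y fᵏ′y≡fᵏleast)
        (All.lookup (f[argmin]≤f[xs] {f = toℕ} y _) (∈-applyUpTo⁺ (λ i → iter f i y) j<n))

numOrbits-≤-conjugate : ∀ (M : PreMap) (f f⁻ g g⁻ h : Fin (PreMap.n M) → Fin (PreMap.n M)) →
                        (∀ x → f⁻ (f x) ≡ x) → (∀ x → g⁻ (g x) ≡ x) →
                        (∀ {x y} → h x ≡ h y → x ≡ y) → (∀ x → g (h x) ≡ h (f x)) →
                        numOrbits M f ≤ numOrbits M g
numOrbits-≤-conjugate M f f⁻ g g⁻ h f⁻∘f g⁻∘g h-injective g∘h≗h∘f = begin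
  numOrbits M f        ≡⟨ F.numOrbits≡countFin ⟩
  countFin F.isLeastᵇ  ≤⟨ countFin-≤-injective (G.least ∘ h)
                            (λ x _ → G.IsLeast⇒isLeastᵇ (G.least-IsLeast (h x))) least-injective ⟩
  countFin G.isLeastᵇ  ≡⟨ G.numOrbits≡countFin ⟨
  numOrbits M g        ∎
  where
    open ≤-Reasoning
    module F = Orbit M f f⁻ f⁻∘f
    module G = Orbit M g g⁻ g⁻∘g

    least-injective : ∀ {x y} → T (F.isLeastᵇ x) → T (F.isLeastᵇ y) →
                      G.least (h x) ≡ G.least (h y) → x ≡ y
    least-injective {x} {y} x-least y-least e
      with k , gᵏhx≡hy ← G.InOrbit-trans (G.InOrbit-least (h x))
                           (subst (λ z → G.InOrbit z (h y)) (sym e) (G.InOrbit-sym (G.InOrbit-least (h y))))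
      = F.IsLeast-unique (k , h-injective (trans (sym (iter-commute h g∘h≗h∘f k x)) gᵏhx≡hy))
                         (F.isLeastᵇ⇒IsLeast x x-least) (F.isLeastᵇ⇒IsLeast y y-least)

module Map (G : PreMap) (isMap : IsMap G) where
  open PreMap G
  open IsMap isMap

  φ⁻ : Fin n → Fin n
  φ⁻ x = α (σ⁻ x)

  φ⁻∘φ : ∀ x → φ⁻ (φ x) ≡ x
  φ⁻∘φ x = trans (cong α (σ⁻-σ (α x))) (α-invol x)

  ψ ψ⁻ : Fin n → Fin n
  ψ x = α (σ x)
  ψ⁻ x = σ⁻ (α x)

  ψ⁻∘ψ : ∀ x → ψ⁻ (ψ x) ≡ x
  ψ⁻∘ψ x = trans (cong σ⁻ (α-invol (σ x))) (σ⁻-σ x)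

  module σ-Orbit  = Orbit G σ σ⁻ σ⁻-σ
  module σ⁻-Orbit = Orbit G σ⁻ σ σ-σ⁻
  module α-Orbit  = Orbit G α α α-invol
  module φ-Orbit  = Orbit G φ φ⁻ φ⁻∘φ
  module ψ-Orbit  = Orbit G ψ ψ⁻ ψ⁻∘ψ

  open α-Orbit  using () renaming (f-injective to α-injective)
  open σ-Orbit  using () renaming (f-injective to σ-injective)
  open σ⁻-Orbit using () renaming (f-injective to σ⁻-injective)

  σ⁻-orbit⊆σ-orbit : ∀ {x y} → σ⁻-Orbit.InOrbit x y → SameVertex G x y
  σ⁻-orbit⊆σ-orbit {x} (k , refl) = σ-Orbit.InOrbit-sym (k , iter-cancel σ-σ⁻ k x)

  σ-orbit⊆σ⁻-orbit : ∀ {x y} → SameVertex G x y → σ⁻-Orbit.InOrbit x y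
  σ-orbit⊆σ⁻-orbit {x} (k , refl) = σ⁻-Orbit.InOrbit-sym (k , iter-cancel σ⁻-σ k x)

  numOrbits-σ⁻ : numOrbits G σ⁻ ≡ numOrbits G σ
  numOrbits-σ⁻ = begin
    numOrbits G σ⁻              ≡⟨ σ⁻-Orbit.numOrbits≡countFin ⟩
    countFin σ⁻-Orbit.isLeastᵇ  ≡⟨ countFin-cong
      (λ x → σ-Orbit.IsLeast⇒isLeastᵇ ∘ IsLeastInOrbit-⊆ (λ k → σ-orbit⊆σ⁻-orbit (k , refl))
                                      ∘ σ⁻-Orbit.isLeastᵇ⇒IsLeast x)
      (λ x → σ⁻-Orbit.IsLeast⇒isLeastᵇ ∘ IsLeastInOrbit-⊆ (λ k → σ⁻-orbit⊆σ-orbit (k , refl))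
                                       ∘ σ-Orbit.isLeastᵇ⇒IsLeast x) ⟩
    countFin σ-Orbit.isLeastᵇ   ≡⟨ σ-Orbit.numOrbits≡countFin ⟨
    numOrbits G σ               ∎
    where open ≡-Reasoning

  -- σ conjugates ψ to φ, and α conjugates φ back to ψ.
  numOrbits-ψ : numOrbits G ψ ≡ numOrbits G φ
  numOrbits-ψ = ≤-antisym
    (numOrbits-≤-conjugate G ψ ψ⁻ φ φ⁻ σ ψ⁻∘ψ φ⁻∘φ σ-injective (λ _ → refl))
    (numOrbits-≤-conjugate G φ φ⁻ ψ ψ⁻ α φ⁻∘φ ψ⁻∘ψ α-injective (λ _ → refl))

  ψ-IsTriangle⇔φ-IsTriangle : ∀ {c} → ψ-Orbit.IsTriangle c ⇔ φ-Orbit.IsTriangle (σ c)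
  ψ-IsTriangle⇔φ-IsTriangle = mk⇔
    (λ (ψ³c≡c , ψc≢c) → cong σ ψ³c≡c , ψc≢c ∘ σ-injective)
    (λ (φ³σc≡σc , φσc≢σc) → σ-injective φ³σc≡σc , φσc≢σc ∘ cong σ)

  α-isLeastᵇ⇔ : ∀ d → T (α-Orbit.isLeastᵇ d) ⇔ toℕ d ≤ toℕ (α d)
  α-isLeastᵇ⇔ d = mk⇔ (λ t → α-Orbit.isLeastᵇ⇒IsLeast d t 1)
                      (α-Orbit.IsLeast⇒isLeastᵇ ∘ IsLeastInOrbit-involution α-invol)

  darts≡edges+edges : n ≡ numOrbits G α + numOrbits G α
  darts≡edges+edges = begin
    n                                        ≡⟨ countFin-+-not least ⟨
    countFin least + countFin (not ∘ least)  ≡⟨ cong (countFin least +_) (countFin-congʷ not-least≗least-α) ⟩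
    countFin least + countFin (least ∘ α)    ≡⟨ cong (countFin least +_) (countFin-∘-involution least α α-invol) ⟩
    countFin least + countFin least          ≡⟨ cong₂ _+_ numOrbits≡ numOrbits≡ ⟨
    numOrbits G α + numOrbits G α            ∎
    where
      open ≡-Reasoning
      least : Fin n → Bool
      least = α-Orbit.isLeastᵇ

      numOrbits≡ : numOrbits G α ≡ countFin least
      numOrbits≡ = α-Orbit.numOrbits≡countFin

      αd≤ααd⇔αd≤d : ∀ {d} → toℕ (α d) ≤ toℕ (α (α d)) ⇔ toℕ (α d) ≤ toℕ d
      αd≤ααd⇔αd≤d {d} = mk⇔ (subst (λ z → toℕ (α d) ≤ toℕ z) (α-invol d))
                            (subst (λ z → toℕ (α d) ≤ toℕ z) (sym (α-invol d)))

      not-least≗least-α : ∀ d → not (least d) ≡ least (α d)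
      not-least≗least-α d with least d in e
      ... | true  = sym (T-injective (λ αd-least → α-fpf d (Fin.toℕ-injective (≤-antisym
                      (Equivalence.to αd≤ααd⇔αd≤d (Equivalence.to (α-isLeastᵇ⇔ (α d)) αd-least))
                      (Equivalence.to (α-isLeastᵇ⇔ d) (subst T (sym e) _)))))
                    (λ ()))
      ... | false = T-injective (λ _ → Equivalence.from (α-isLeastᵇ⇔ (α d)) (Equivalence.from αd≤ααd⇔αd≤d
                      (<⇒≤ (≰⇒> (subst T e ∘ Equivalence.from (α-isLeastᵇ⇔ d))))))
                    _

  SameEdge : Fin n → Fin n → Set
  SameEdge a b = b ≡ a ⊎ b ≡ α a

  edgeRep : Fin n → Fin n
  edgeRep y with toℕ y ≤? toℕ (α y)
  ... | yes _ = y
  ... | no  _ = α y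

  SameEdge-edgeRep : ∀ y → SameEdge y (edgeRep y)
  SameEdge-edgeRep y with toℕ y ≤? toℕ (α y)
  ... | yes _ = inj₁ refl
  ... | no  _ = inj₂ refl

  edgeRep-≤ : ∀ y → toℕ (edgeRep y) ≤ toℕ (α (edgeRep y))
  edgeRep-≤ y with toℕ y ≤? toℕ (α y)
  ... | yes y≤αy = y≤αy
  ... | no  y≰αy = subst (λ z → toℕ (α y) ≤ toℕ z) (sym (α-invol y)) (<⇒≤ (≰⇒> y≰αy))

  edgeRep-canonical : ∀ {y z} → toℕ y ≤ toℕ (α y) → SameEdge z y → edgeRep z ≡ y
  edgeRep-canonical {y} {z} y≤αy z~y with toℕ z ≤? toℕ (α z) | z~y
  ... | yes _    | inj₁ refl = refl
  ... | no  z≰αz | inj₁ refl = ⊥-elim (z≰αz y≤αy)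
  ... | no  _    | inj₂ refl = refl
  ... | yes z≤αz | inj₂ refl = ⊥-elim (α-fpf z (Fin.toℕ-injective
                                 (≤-antisym (subst (λ w → toℕ (α z) ≤ toℕ w) (α-invol z) y≤αy) z≤αz)))

  edgeRep-injective : ∀ {a b} → ¬ SameEdge a b → edgeRep a ≢ edgeRep b
  edgeRep-injective {a} {b} a≁b e with SameEdge-edgeRep a | SameEdge-edgeRep b
  ... | inj₁ ra≡a  | inj₁ rb≡b  = a≁b (inj₁ (trans (sym rb≡b) (trans (sym e) ra≡a)))
  ... | inj₁ ra≡a  | inj₂ rb≡αb =
    a≁b (inj₂ (trans (sym (α-invol b)) (cong α (trans (sym rb≡αb) (trans (sym e) ra≡a)))))
  ... | inj₂ ra≡αa | inj₁ rb≡b  = a≁b (inj₂ (trans (sym rb≡b) (trans (sym e) ra≡αa)))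
  ... | inj₂ ra≡αa | inj₂ rb≡αb = a≁b (inj₁ (α-injective (trans (sym rb≡αb) (trans (sym e) ra≡αa))))

  onFaceᵇ : Fin n → Fin n → Bool
  onFaceᵇ x y = (inOrbitᵇ G φ x y ∨ inOrbitᵇ G φ x (α y)) ∧ (toℕ y ≤ᵇ toℕ (α y))

  faceDeg≡countFin : ∀ x → faceDeg G x ≡ countFin (onFaceᵇ x)
  faceDeg≡countFin x = count≡countFin G (onFaceᵇ x)

  onFaceᵇ⇒ : ∀ x y → T (onFaceᵇ x y) → ∃[ w ] SameFace G x w × SameEdge w y × toℕ y ≤ toℕ (α y)
  onFaceᵇ⇒ x y t
    with t∨ , y≤αy ← Equivalence.to (T-∧ {inOrbitᵇ G φ x y ∨ inOrbitᵇ G φ x (α y)}) t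
    with Equivalence.to (T-∨ {inOrbitᵇ G φ x y}) t∨
  ... | inj₁ x~y  = y   , φ-Orbit.inOrbitᵇ⇒InOrbit x y x~y , inj₁ refl , ≤ᵇ⇒≤ _ _ y≤αy
  ... | inj₂ x~αy = α y , φ-Orbit.inOrbitᵇ⇒InOrbit x (α y) x~αy , inj₂ (sym (α-invol y)) , ≤ᵇ⇒≤ _ _ y≤αy

  ⇒onFaceᵇ : ∀ {x w y} → SameFace G x w → SameEdge w y → toℕ y ≤ toℕ (α y) → T (onFaceᵇ x y)
  ⇒onFaceᵇ {x} {w} {y} x~w w~y y≤αy =
    Equivalence.from T-∧ (Equivalence.from T-∨ (on-face w~y) , ≤⇒≤ᵇ y≤αy)
    where
      on-face : SameEdge w y → T (inOrbitᵇ G φ x y) ⊎ T (inOrbitᵇ G φ x (α y))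
      on-face (inj₁ refl) = inj₁ (φ-Orbit.InOrbit⇒inOrbitᵇ x~w)
      on-face (inj₂ refl) = inj₂ (φ-Orbit.InOrbit⇒inOrbitᵇ (subst (SameFace G x) (sym (α-invol w)) x~w))

  faceDeg-cong : ∀ {x z} → SameFace G x z → faceDeg G x ≡ faceDeg G z
  faceDeg-cong {x} {z} x~z = begin
    faceDeg G x           ≡⟨ faceDeg≡countFin x ⟩
    countFin (onFaceᵇ x)  ≡⟨ countFin-cong (move x~z) (move (φ-Orbit.InOrbit-sym x~z)) ⟩
    countFin (onFaceᵇ z)  ≡⟨ faceDeg≡countFin z ⟨
    faceDeg G z           ∎
    where
      open ≡-Reasoning
      move : ∀ {a b} → SameFace G a b → ∀ y → T (onFaceᵇ a y) → T (onFaceᵇ b y)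
      move {a} {b} a~b y t with w , a~w , w~y , y≤αy ← onFaceᵇ⇒ a y t =
        ⇒onFaceᵇ (φ-Orbit.InOrbit-trans (φ-Orbit.InOrbit-sym a~b) a~w) w~y y≤αy

  faceDeg-≤ : ∀ {x} (ws : List (Fin n)) → (∀ {w} → SameFace G x w → w ∈ ws) → faceDeg G x ≤ length ws
  faceDeg-≤ {x} ws face⊆ws = begin
    faceDeg G x              ≡⟨ faceDeg≡countFin x ⟩
    countFin (onFaceᵇ x)     ≤⟨ countFin-≤-length (map edgeRep ws) on-face⇒∈ ⟩
    length (map edgeRep ws)  ≡⟨ length-map edgeRep ws ⟩
    length ws                ∎
    where
      open ≤-Reasoning
      on-face⇒∈ : ∀ y → T (onFaceᵇ x y) → y ∈ map edgeRep ws
      on-face⇒∈ y t with w , x~w , w~y , y≤αy ← onFaceᵇ⇒ x y t =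
        subst (_∈ map edgeRep ws) (edgeRep-canonical y≤αy w~y) (∈-map⁺ edgeRep (face⊆ws x~w))

  length-≤-faceDeg : ∀ {x} (ws : List (Fin n)) → AllPairs (λ a b → ¬ SameEdge a b) ws →
                     All (SameFace G x) ws → length ws ≤ faceDeg G x
  length-≤-faceDeg {x} ws distinct on-face = begin
    length ws                ≡⟨ length-map edgeRep ws ⟨
    length (map edgeRep ws)  ≤⟨ length-≤-countFin (map edgeRep ws)
                                  (AllPairs.map⁺ (AllPairs.map edgeRep-injective distinct))
                                  (All.map⁺ (All.map edgeRep-on-face on-face)) ⟩
    countFin (onFaceᵇ x)     ≡⟨ faceDeg≡countFin x ⟨
    faceDeg G x              ∎
    where
      open ≤-Reasoning
      edgeRep-on-face : ∀ {w} → SameFace G x w → T (onFaceᵇ x (edgeRep w))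
      edgeRep-on-face {w} x~w = ⇒onFaceᵇ x~w (SameEdge-edgeRep w) (edgeRep-≤ w)

  corner-condition⇔ :
    (∀ x y → ∃[ z ] (SameVertex G x z × SameFace G y z) → (vertexDeg G x ≡ 3) ⊎ (faceDeg G y ≡ 3))
    ⇔ (∀ z → (vertexDeg G z ≡ 3) ⊎ (faceDeg G z ≡ 3))
  corner-condition⇔ = mk⇔
    (λ corners z → corners z z (z , σ-Orbit.InOrbit-refl , φ-Orbit.InOrbit-refl))
    (λ corners x y (z , x~z , y~z) →
      Sum.map (trans (σ-Orbit.orbitSize-cong x~z)) (trans (faceDeg-cong y~z)) (corners z))

  module Simple (simple : IsSimple G) (σx≢x : ∀ x → σ x ≢ x) where
    noLoops : NoLoops G
    noLoops = proj₁ simple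

    noMultipleEdges : NoMultipleEdges G
    noMultipleEdges = proj₂ simple

    no-loop : ∀ x → ¬ SameVertex G (α x) x
    no-loop x = noLoops (α x) ∘ subst (SameVertex G (α x)) (sym (α-invol x))

    φx≢x : ∀ x → φ x ≢ x
    φx≢x x e = no-loop x (1 , e)

    φx≢αx : ∀ x → φ x ≢ α x
    φx≢αx x = σx≢x (α x)

    -- Otherwise α x and φ x would be two distinct edges joining the same two vertices.
    no-digon : ∀ x → ¬ SameVertex G x (α (φ x))
    no-digon x x~αφx with noMultipleEdges (α x) (φ x) (1 , refl)
                            (subst (λ w → SameVertex G w (α (φ x))) (sym (α-invol x)) x~αφx)
    ... | inj₁ αx≡φx  = φx≢αx x (sym αx≡φx)
    ... | inj₂ αx≡αφx = φx≢x x (sym (α-injective αx≡αφx))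

    φ²x≢x : ∀ x → φ (φ x) ≢ x
    φ²x≢x x e = no-digon x (σ-Orbit.InOrbit-sym (1 , e))

    φ²x≢αx : ∀ x → φ (φ x) ≢ α x
    φ²x≢αx x e = no-loop (φ x) (2 , cong σ e)

    φ³x≢αx : ∀ x → φ (φ (φ x)) ≢ α x
    φ³x≢αx x e = no-digon (φ x) (σ-Orbit.InOrbit-sym (2 , cong σ e))

    ¬SameEdge-φ : ∀ x → ¬ SameEdge x (φ x)
    ¬SameEdge-φ x = Sum.[ φx≢x x , φx≢αx x ]

    ¬SameEdge-φ² : ∀ x → ¬ SameEdge x (φ (φ x))
    ¬SameEdge-φ² x = Sum.[ φ²x≢x x , φ²x≢αx x ]

    3≤faceDeg : ∀ x → 3 ≤ faceDeg G x
    3≤faceDeg x = length-≤-faceDeg (x ∷ φ x ∷ φ (φ x) ∷ [])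
      ((¬SameEdge-φ x ∷ ¬SameEdge-φ² x ∷ []) ∷ (¬SameEdge-φ (φ x) ∷ []) ∷ [] ∷ [])
      ((0 , refl) ∷ (1 , refl) ∷ (2 , refl) ∷ [])

    faceDeg≡3⇔IsTriangle : ∀ {x} → faceDeg G x ≡ 3 ⇔ φ-Orbit.IsTriangle x
    faceDeg≡3⇔IsTriangle {x} = mk⇔ triangle
      (λ (φ³x≡x , _) → ≤-antisym
        (faceDeg-≤ (x ∷ φ x ∷ φ (φ x) ∷ []) (φ-Orbit.InOrbit-periodic φ³x≡x)) (3≤faceDeg x))
      where
        triangle : faceDeg G x ≡ 3 → φ-Orbit.IsTriangle x
        triangle deg≡3 with φ (φ (φ x)) Fin.≟ x
        ... | yes φ³x≡x = φ³x≡x , φx≢x x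
        ... | no  φ³x≢x = ⊥-elim (1+n≰n (≤-trans 4≤faceDeg (≤-reflexive deg≡3)))
          where
            4≤faceDeg : 4 ≤ faceDeg G x
            4≤faceDeg = length-≤-faceDeg (x ∷ φ x ∷ φ (φ x) ∷ φ (φ (φ x)) ∷ [])
              ((¬SameEdge-φ x ∷ ¬SameEdge-φ² x ∷ Sum.[ φ³x≢x , φ³x≢αx x ] ∷ [])
               ∷ (¬SameEdge-φ (φ x) ∷ ¬SameEdge-φ² (φ x) ∷ [])
               ∷ (¬SameEdge-φ (φ (φ x)) ∷ []) ∷ [] ∷ [])
              ((0 , refl) ∷ (1 , refl) ∷ (2 , refl) ∷ (3 , refl) ∷ [])

    SameEdge-σ-injective : ∀ {a b} → SameEdge a b → SameEdge (σ a) (σ b) → a ≡ b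
    SameEdge-σ-injective     (inj₁ refl) _              = refl
    SameEdge-σ-injective {a} (inj₂ refl) (inj₁ σαa≡σa)  = ⊥-elim (α-fpf a (σ-injective σαa≡σa))
    SameEdge-σ-injective {a} (inj₂ refl) (inj₂ σαa≡ασa)
      with noMultipleEdges a (σ a) (1 , refl) (1 , σαa≡ασa)
    ... | inj₁ a≡σa  = ⊥-elim (σx≢x a (sym a≡σa))
    ... | inj₂ a≡ασa = ⊥-elim (noLoops a (1 , trans (sym (α-invol (σ a))) (cong α (sym a≡ασa))))

    SameEdge-σ⁻-injective : ∀ {a b} → SameEdge a b → SameEdge (σ⁻ a) (σ⁻ b) → a ≡ b
    SameEdge-σ⁻-injective     (inj₁ refl) _                = refl
    SameEdge-σ⁻-injective {a} (inj₂ refl) (inj₁ σ⁻αa≡σ⁻a)  = ⊥-elim (α-fpf a (σ⁻-injective σ⁻αa≡σ⁻a))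
    SameEdge-σ⁻-injective {a} (inj₂ refl) (inj₂ σ⁻αa≡ασ⁻a)
      with noMultipleEdges (σ⁻ a) a (1 , σ-σ⁻ a) (1 , trans (cong σ (sym σ⁻αa≡ασ⁻a)) (σ-σ⁻ (α a)))
    ... | inj₁ σ⁻a≡a  = ⊥-elim (σx≢x a (trans (cong σ (sym σ⁻a≡a)) (σ-σ⁻ a)))
    ... | inj₂ σ⁻a≡αa = ⊥-elim (no-loop a (1 , trans (cong σ (sym σ⁻a≡αa)) (σ-σ⁻ a)))

    SameEdge-σ-σ⁻ : (∀ x → σ (σ x) ≢ x) → ∀ {a b} → SameEdge a b → ¬ SameEdge (σ a) (σ⁻ b)
    SameEdge-σ-σ⁻ σσx≢x {a} (inj₁ refl) (inj₁ σ⁻a≡σa)  = σσx≢x a (trans (cong σ (sym σ⁻a≡σa)) (σ-σ⁻ a))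
    SameEdge-σ-σ⁻ σσx≢x {a} (inj₁ refl) (inj₂ σ⁻a≡ασa) =
      no-loop (σ a) (2 , cong σ (trans (cong σ (sym σ⁻a≡ασa)) (σ-σ⁻ a)))
    SameEdge-σ-σ⁻ σσx≢x {a} (inj₂ refl) (inj₁ σ⁻αa≡σa) =
      noLoops a (2 , trans (cong σ (sym σ⁻αa≡σa)) (σ-σ⁻ (α a)))
    SameEdge-σ-σ⁻ σσx≢x {a} (inj₂ refl) (inj₂ σ⁻αa≡ασa)
      with noMultipleEdges (α (σ a)) (α a) (1 , trans (cong σ (sym σ⁻αa≡ασa)) (σ-σ⁻ (α a)))
             (subst₂ (SameVertex G) (sym (α-invol (σ a))) (sym (α-invol a)) (σ-Orbit.InOrbit-sym (1 , refl)))
    ... | inj₁ ασa≡αa  = σx≢x a (α-injective ασa≡αa)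
    ... | inj₂ ασa≡ααa = noLoops a (1 , α-injective ασa≡ααa)

module Medial (G : PreMap) (isMap : IsMap G) where
  open PreMap G
  open IsMap isMap
  open Map G isMap

  M : PreMap
  M = medial G

  α′ σ′ σ′⁻ φ′ : Fin (n + n) → Fin (n + n)
  α′  = PreMap.α M
  σ′  = PreMap.σ M
  σ′⁻ = PreMap.σ⁻ M
  φ′  = PreMap.φ M

  -- The darts written (d , true) and (d , false) in the definition of medial.
  fwd bwd : Fin n → Fin (n + n)
  fwd d = d ↑ˡ n
  bwd d = n ↑ʳ d

  α′-fwd : ∀ d → α′ (fwd d) ≡ bwd (σ d)
  α′-fwd d rewrite Fin.splitAt-↑ˡ n d n = refl

  α′-bwd : ∀ d → α′ (bwd d) ≡ fwd (σ⁻ d)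
  α′-bwd d rewrite Fin.splitAt-↑ʳ n n d = refl

  σ′-fwd : ∀ d → σ′ (fwd d) ≡ bwd d
  σ′-fwd d rewrite Fin.splitAt-↑ˡ n d n = refl

  σ′-bwd : ∀ d → σ′ (bwd d) ≡ fwd (α d)
  σ′-bwd d rewrite Fin.splitAt-↑ʳ n n d = refl

  σ′⁻-fwd : ∀ d → σ′⁻ (fwd d) ≡ bwd (α d)
  σ′⁻-fwd d rewrite Fin.splitAt-↑ˡ n d n = refl

  σ′⁻-bwd : ∀ d → σ′⁻ (bwd d) ≡ fwd d
  σ′⁻-bwd d rewrite Fin.splitAt-↑ʳ n n d = refl

  φ′-fwd : ∀ d → φ′ (fwd d) ≡ fwd (ψ d)
  φ′-fwd d = trans (cong σ′ (α′-fwd d)) (σ′-bwd (σ d))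

  φ′-bwd : ∀ d → φ′ (bwd d) ≡ bwd (σ⁻ d)
  φ′-bwd d = trans (cong σ′ (α′-bwd d)) (σ′-fwd (σ⁻ d))

  data Dart : Fin (n + n) → Set where
    fwd-dart : ∀ d → Dart (fwd d)
    bwd-dart : ∀ d → Dart (bwd d)

  dart : ∀ y → Dart y
  dart y with splitAt n y in e
  ... | inj₁ d = subst Dart (Fin.splitAt⁻¹-↑ˡ e) (fwd-dart d)
  ... | inj₂ d = subst Dart (Fin.splitAt⁻¹-↑ʳ e) (bwd-dart d)

  edgeOf : ∀ {y} → Dart y → Fin n
  edgeOf (fwd-dart d) = d
  edgeOf (bwd-dart d) = d

  fwd-injective : ∀ {a b} → fwd a ≡ fwd b → a ≡ b
  fwd-injective = Fin.↑ˡ-injective n _ _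

  bwd-injective : ∀ {a b} → bwd a ≡ bwd b → a ≡ b
  bwd-injective = Fin.↑ʳ-injective n _ _

  -- Stated with 0 + to match toℕ-bwd in the uses of IsLeastInOrbit-shift.
  toℕ-fwd : ∀ d → toℕ (fwd d) ≡ 0 + toℕ d
  toℕ-fwd d = Fin.toℕ-↑ˡ d n

  toℕ-bwd : ∀ d → toℕ (bwd d) ≡ n + toℕ d
  toℕ-bwd d = Fin.toℕ-↑ʳ n d

  fwd<bwd : ∀ a b → toℕ (fwd a) < toℕ (bwd b)
  fwd<bwd a b = subst₂ _<_ (sym (toℕ-fwd a)) (sym (toℕ-bwd b)) (<-≤-trans (Fin.toℕ<n a) (m≤m+n n (toℕ b)))

  fwd≢bwd : ∀ {a b} → fwd a ≢ bwd b
  fwd≢bwd {a} {b} e = <-irrefl (cong toℕ e) (fwd<bwd a b)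

  α′-invol : ∀ x → α′ (α′ x) ≡ x
  α′-invol x with dart x
  ... | fwd-dart d = trans (cong α′ (α′-fwd d)) (trans (α′-bwd (σ d)) (cong fwd (σ⁻-σ d)))
  ... | bwd-dart d = trans (cong α′ (α′-bwd d)) (trans (α′-fwd (σ⁻ d)) (cong bwd (σ-σ⁻ d)))

  α′-fpf : ∀ x → α′ x ≢ x
  α′-fpf x with dart x
  ... | fwd-dart d = λ e → fwd≢bwd (trans (sym e) (α′-fwd d))
  ... | bwd-dart d = λ e → fwd≢bwd (trans (sym (α′-bwd d)) e)

  σ′-σ′⁻ : ∀ x → σ′ (σ′⁻ x) ≡ x
  σ′-σ′⁻ x with dart x
  ... | fwd-dart d = trans (cong σ′ (σ′⁻-fwd d)) (trans (σ′-bwd (α d)) (cong fwd (α-invol d)))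
  ... | bwd-dart d = trans (cong σ′ (σ′⁻-bwd d)) (σ′-fwd d)

  σ′⁻-σ′ : ∀ x → σ′⁻ (σ′ x) ≡ x
  σ′⁻-σ′ x with dart x
  ... | fwd-dart d = trans (cong σ′⁻ (σ′-fwd d)) (σ′⁻-bwd d)
  ... | bwd-dart d = trans (cong σ′⁻ (σ′-bwd d)) (trans (σ′⁻-fwd (α d)) (cong bwd (α-invol d)))

  isMap-medial : IsMap M
  isMap-medial = record { α-invol = α′-invol ; α-fpf = α′-fpf ; σ-σ⁻ = σ′-σ′⁻ ; σ⁻-σ = σ′⁻-σ′ }

  module M′ = Map M isMap-medial

  medialVertex : Fin n → List (Fin (n + n))
  medialVertex a = fwd a ∷ bwd a ∷ fwd (α a) ∷ bwd (α a) ∷ []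

  ∈medialVertex : ∀ {x} (dx : Dart x) → x ∈ medialVertex (edgeOf dx)
  ∈medialVertex (fwd-dart d) = here refl
  ∈medialVertex (bwd-dart d) = there (here refl)

  medialVertex-distinct : ∀ a → AllPairs _≢_ (medialVertex a)
  medialVertex-distinct a =
    (fwd≢bwd ∷ α-fpf a ∘ sym ∘ fwd-injective ∷ fwd≢bwd ∷ [])
    ∷ (fwd≢bwd ∘ sym ∷ α-fpf a ∘ sym ∘ bwd-injective ∷ []) ∷ (fwd≢bwd ∷ []) ∷ [] ∷ []

  fwd~medialVertex : ∀ {a y} → y ∈ medialVertex a → SameVertex M (fwd a) y
  fwd~medialVertex {a} (here refl)                         = 0 , refl
  fwd~medialVertex {a} (there (here refl))                 = 1 , σ′-fwd a
  fwd~medialVertex {a} (there (there (here refl)))         = 2 , trans (cong σ′ (σ′-fwd a)) (σ′-bwd a)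
  fwd~medialVertex {a} (there (there (there (here refl)))) =
    3 , trans (cong σ′ (trans (cong σ′ (σ′-fwd a)) (σ′-bwd a))) (σ′-fwd (α a))

  σ′-medialVertex : ∀ {a y} → y ∈ medialVertex a → σ′ y ∈ medialVertex a
  σ′-medialVertex {a} (here refl)                         = there (here (σ′-fwd a))
  σ′-medialVertex {a} (there (here refl))                 = there (there (here (σ′-bwd a)))
  σ′-medialVertex {a} (there (there (here refl)))         = there (there (there (here (σ′-fwd (α a)))))
  σ′-medialVertex {a} (there (there (there (here refl)))) = here (trans (σ′-bwd (α a)) (cong fwd (α-invol a)))

  SameVertex-medialVertex : ∀ {a y z} → SameVertex M y z → y ∈ medialVertex a → z ∈ medialVertex a
  SameVertex-medialVertex (zero  , refl) y∈ = y∈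
  SameVertex-medialVertex (suc k , refl) y∈ = σ′-medialVertex (SameVertex-medialVertex (k , refl) y∈)

  vertexDeg-medial : ∀ x → vertexDeg M x ≡ 4
  vertexDeg-medial x = ≤-antisym
    (M′.σ-Orbit.orbitSize-≤-length (medialVertex a) (λ x~y → SameVertex-medialVertex x~y x∈))
    (M′.σ-Orbit.length-≤-orbitSize (medialVertex a) (medialVertex-distinct a) (All.tabulate x~))
    where
      a : Fin n
      a = edgeOf (dart x)

      x∈ : x ∈ medialVertex a
      x∈ = ∈medialVertex (dart x)

      x~ : ∀ {y} → y ∈ medialVertex a → SameVertex M x y
      x~ y∈ = M′.σ-Orbit.InOrbit-trans (M′.σ-Orbit.InOrbit-sym (fwd~medialVertex x∈)) (fwd~medialVertex y∈)

  SameVertex⇒SameEdge : ∀ {x y} (dx : Dart x) (dy : Dart y) → SameVertex M x y → SameEdge (edgeOf dx) (edgeOf dy)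
  SameVertex⇒SameEdge dx dy x~y = ∈⇒SameEdge dy (SameVertex-medialVertex x~y (∈medialVertex dx))
    where
      ∈⇒SameEdge : ∀ {a y} (dy : Dart y) → y ∈ medialVertex a → SameEdge a (edgeOf dy)
      ∈⇒SameEdge (fwd-dart d) (here e)                         = inj₁ (fwd-injective e)
      ∈⇒SameEdge (fwd-dart d) (there (here e))                 = ⊥-elim (fwd≢bwd e)
      ∈⇒SameEdge (fwd-dart d) (there (there (here e)))         = inj₂ (fwd-injective e)
      ∈⇒SameEdge (fwd-dart d) (there (there (there (here e)))) = ⊥-elim (fwd≢bwd e)
      ∈⇒SameEdge (bwd-dart d) (here e)                         = ⊥-elim (fwd≢bwd (sym e))
      ∈⇒SameEdge (bwd-dart d) (there (here e))                 = inj₁ (bwd-injective e)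
      ∈⇒SameEdge (bwd-dart d) (there (there (here e)))         = ⊥-elim (fwd≢bwd (sym e))
      ∈⇒SameEdge (bwd-dart d) (there (there (there (here e)))) = inj₂ (bwd-injective e)

  module _ (simple : IsSimple G) (3≤vertexDeg : ∀ x → 3 ≤ vertexDeg G x) where
    private
      σx≢x : ∀ x → σ x ≢ x
      σx≢x x = proj₁ (Equivalence.to σ-Orbit.3≤orbitSize⇔ (3≤vertexDeg x))

      σσx≢x : ∀ x → σ (σ x) ≢ x
      σσx≢x x = proj₂ (Equivalence.to σ-Orbit.3≤orbitSize⇔ (3≤vertexDeg x))

      open Simple simple σx≢x

    noLoops-medial : NoLoops M
    noLoops-medial x x~α′x with dart x
    ... | fwd-dart a
      with SameVertex⇒SameEdge (fwd-dart a) (bwd-dart (σ a)) (subst (SameVertex M (fwd a)) (α′-fwd a) x~α′x)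
    ...   | inj₁ σa≡a  = σx≢x a σa≡a
    ...   | inj₂ σa≡αa = noLoops a (1 , σa≡αa)
    noLoops-medial x x~α′x | bwd-dart a
      with SameVertex⇒SameEdge (bwd-dart a) (fwd-dart (σ⁻ a)) (subst (SameVertex M (bwd a)) (α′-bwd a) x~α′x)
    ...   | inj₁ σ⁻a≡a  = σx≢x a (trans (cong σ (sym σ⁻a≡a)) (σ-σ⁻ a))
    ...   | inj₂ σ⁻a≡αa = no-loop a (1 , trans (cong σ (sym σ⁻a≡αa)) (σ-σ⁻ a))

    noMultipleEdges-medial : NoMultipleEdges M
    noMultipleEdges-medial x y x~y α′x~α′y with dart x | dart y
    ... | fwd-dart a | fwd-dart b = inj₁ (cong fwd (SameEdge-σ-injective
            (SameVertex⇒SameEdge (fwd-dart a) (fwd-dart b) x~y)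
            (SameVertex⇒SameEdge (bwd-dart (σ a)) (bwd-dart (σ b))
              (subst₂ (SameVertex M) (α′-fwd a) (α′-fwd b) α′x~α′y))))
    ... | bwd-dart a | bwd-dart b = inj₁ (cong bwd (SameEdge-σ⁻-injective
            (SameVertex⇒SameEdge (bwd-dart a) (bwd-dart b) x~y)
            (SameVertex⇒SameEdge (fwd-dart (σ⁻ a)) (fwd-dart (σ⁻ b))
              (subst₂ (SameVertex M) (α′-bwd a) (α′-bwd b) α′x~α′y))))
    ... | fwd-dart a | bwd-dart b = ⊥-elim (SameEdge-σ-σ⁻ σσx≢x
            (SameVertex⇒SameEdge (fwd-dart a) (bwd-dart b) x~y)
            (SameVertex⇒SameEdge (bwd-dart (σ a)) (fwd-dart (σ⁻ b))
              (subst₂ (SameVertex M) (α′-fwd a) (α′-bwd b) α′x~α′y)))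
    ... | bwd-dart a | fwd-dart b = ⊥-elim (SameEdge-σ-σ⁻ σσx≢x
            (SameVertex⇒SameEdge (fwd-dart b) (bwd-dart a) (M′.σ-Orbit.InOrbit-sym x~y))
            (SameVertex⇒SameEdge (bwd-dart (σ b)) (fwd-dart (σ⁻ a))
              (M′.σ-Orbit.InOrbit-sym (subst₂ (SameVertex M) (α′-bwd a) (α′-fwd b) α′x~α′y))))

  luneFree-medial⇒3≤vertexDeg : IsLuneFree M → ∀ x → 3 ≤ vertexDeg G x
  luneFree-medial⇒3≤vertexDeg (noLoops′ , noMultipleEdges′) x =
    Equivalence.from σ-Orbit.3≤orbitSize⇔ (σx≢x x , σσx≢x x)
    where
      σx≢x : ∀ a → σ a ≢ a
      σx≢x a σa≡a = noLoops′ (fwd a) (1 , trans (σ′-fwd a) (sym (trans (α′-fwd a) (cong bwd σa≡a))))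

      σσx≢x : ∀ a → σ (σ a) ≢ a
      σσx≢x a σσa≡a with noMultipleEdges′ (fwd a) (bwd a) (1 , σ′-fwd a)
                          (subst₂ (SameVertex M) (sym (α′-fwd a)) (sym (trans (α′-bwd a) (cong fwd σ⁻a≡σa)))
                             (M′.σ-Orbit.InOrbit-sym (1 , σ′-fwd (σ a))))
        where
          σ⁻a≡σa : σ⁻ a ≡ σ a
          σ⁻a≡σa = trans (cong σ⁻ (sym σσa≡a)) (σ⁻-σ (σ a))
      ... | inj₁ fwd≡bwd   = fwd≢bwd fwd≡bwd
      ... | inj₂ fwd≡α′bwd = σx≢x a (trans (cong σ (fwd-injective (trans fwd≡α′bwd (α′-bwd a)))) (σ-σ⁻ a))

  private
    Step′ : Fin (n + n) → Fin (n + n) → Set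
    Step′ u v = (v ≡ α′ u) ⊎ (v ≡ σ′ u)

    α′-path : ∀ {u v} → α′ u ≡ v → Star Step′ u v
    α′-path e = inj₁ (sym e) ◅ ε

    σ′-path : ∀ {u v} → σ′ u ≡ v → Star Step′ u v
    σ′-path e = inj₂ (sym e) ◅ ε

    fwd⇝bwd : ∀ d → Star Step′ (fwd d) (bwd d)
    fwd⇝bwd d = σ′-path (σ′-fwd d)

    bwd⇝fwd : ∀ d → Star Step′ (bwd d) (fwd d)
    bwd⇝fwd d = σ′-path (σ′-bwd d) ◅◅ σ′-path (σ′-fwd (α d))
             ◅◅ σ′-path (trans (σ′-bwd (α d)) (cong fwd (α-invol d)))

    fwd-step : ∀ {u v} → (v ≡ α u) ⊎ (v ≡ σ u) → Star Step′ (fwd u) (fwd v)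
    fwd-step {u} (inj₁ refl) = fwd⇝bwd u ◅◅ σ′-path (σ′-bwd u)
    fwd-step {u} (inj₂ refl) = α′-path (α′-fwd u) ◅◅ bwd⇝fwd (σ u)

  connected-medial : Connected G → Connected M
  connected-medial connected x y with dart x | dart y
  ... | fwd-dart a | fwd-dart b = kleisliStar fwd fwd-step (connected a b)
  ... | fwd-dart a | bwd-dart b = kleisliStar fwd fwd-step (connected a b) ◅◅ fwd⇝bwd b
  ... | bwd-dart a | fwd-dart b = bwd⇝fwd a ◅◅ kleisliStar fwd fwd-step (connected a b)
  ... | bwd-dart a | bwd-dart b = bwd⇝fwd a ◅◅ kleisliStar fwd fwd-step (connected a b) ◅◅ fwd⇝bwd b

  countFin-fwd : ∀ (p : Fin (n + n) → Bool) → (∀ d → ¬ T (p (bwd d))) → countFin p ≡ countFin (p ∘ fwd)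
  countFin-fwd p ¬p-bwd = begin
    countFin p                                ≡⟨ countFin-↑ n p ⟩
    countFin (p ∘ fwd) + countFin (p ∘ bwd)   ≡⟨ cong (countFin (p ∘ fwd) +_) (countFin-false ¬p-bwd) ⟩
    countFin (p ∘ fwd) + 0                    ≡⟨ +-identityʳ _ ⟩
    countFin (p ∘ fwd)                        ∎
    where open ≡-Reasoning

  fwd≤α′fwd : ∀ d → toℕ (fwd d) ≤ toℕ (α′ (fwd d))
  fwd≤α′fwd d = subst (λ z → toℕ (fwd d) ≤ toℕ z) (sym (α′-fwd d)) (<⇒≤ (fwd<bwd d (σ d)))

  α′bwd<bwd : ∀ d → toℕ (α′ (bwd d)) < toℕ (bwd d)
  α′bwd<bwd d = subst (λ z → toℕ z < toℕ (bwd d)) (sym (α′-bwd d)) (fwd<bwd (σ⁻ d) d)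

  faceDeg-medial : ∀ x → faceDeg M x ≡ countFin (M′.onFaceᵇ x ∘ fwd)
  faceDeg-medial x = trans (M′.faceDeg≡countFin x) (countFin-fwd (M′.onFaceᵇ x) bwd-not-counted)
    where
      bwd-not-counted : ∀ d → ¬ T (M′.onFaceᵇ x (bwd d))
      bwd-not-counted d t with _ , _ , _ , bwd≤α′bwd ← M′.onFaceᵇ⇒ x (bwd d) t =
        <⇒≱ (α′bwd<bwd d) bwd≤α′bwd

  faceDeg-medial-fwd : ∀ c → faceDeg M (fwd c) ≡ orbitSize G ψ c
  faceDeg-medial-fwd c = begin
    faceDeg M (fwd c)                    ≡⟨ faceDeg-medial (fwd c) ⟩
    countFin (M′.onFaceᵇ (fwd c) ∘ fwd)  ≡⟨ countFin-cong on-face⇒orbit orbit⇒on-face ⟩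
    countFin (inOrbitᵇ G ψ c)            ≡⟨ ψ-Orbit.orbitSize≡countFin c ⟨
    orbitSize G ψ c                      ∎
    where
      open ≡-Reasoning
      on-face⇒orbit : ∀ d → T (M′.onFaceᵇ (fwd c) (fwd d)) → T (inOrbitᵇ G ψ c d)
      on-face⇒orbit d t
        with _ , (k , refl) , d~w , _ ← M′.onFaceᵇ⇒ (fwd c) (fwd d) t
        with d~w | iter-commute fwd φ′-fwd k c
      ... | inj₁ fwd-d≡φ′ᵏ   | φ′ᵏ≡fwd-ψᵏ =
        ψ-Orbit.InOrbit⇒inOrbitᵇ (k , sym (fwd-injective (trans fwd-d≡φ′ᵏ φ′ᵏ≡fwd-ψᵏ)))
      ... | inj₂ fwd-d≡α′φ′ᵏ | φ′ᵏ≡fwd-ψᵏ =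
        ⊥-elim (fwd≢bwd (trans fwd-d≡α′φ′ᵏ (trans (cong α′ φ′ᵏ≡fwd-ψᵏ) (α′-fwd _))))

      orbit⇒on-face : ∀ d → T (inOrbitᵇ G ψ c d) → T (M′.onFaceᵇ (fwd c) (fwd d))
      orbit⇒on-face d t with k , ψᵏc≡d ← ψ-Orbit.inOrbitᵇ⇒InOrbit c d t =
        M′.⇒onFaceᵇ (k , trans (iter-commute fwd φ′-fwd k c) (cong fwd ψᵏc≡d)) (inj₁ refl) (fwd≤α′fwd d)

  faceDeg-medial-bwd : ∀ c → faceDeg M (bwd c) ≡ vertexDeg G c
  faceDeg-medial-bwd c = begin
    faceDeg M (bwd c)                    ≡⟨ faceDeg-medial (bwd c) ⟩
    countFin (M′.onFaceᵇ (bwd c) ∘ fwd)  ≡⟨ countFin-cong on-face⇒orbit orbit⇒on-face ⟩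
    countFin (inOrbitᵇ G σ c)            ≡⟨ σ-Orbit.orbitSize≡countFin c ⟨
    vertexDeg G c                        ∎
    where
      open ≡-Reasoning
      on-face⇒orbit : ∀ d → T (M′.onFaceᵇ (bwd c) (fwd d)) → T (inOrbitᵇ G σ c d)
      on-face⇒orbit d t
        with _ , (k , refl) , d~w , _ ← M′.onFaceᵇ⇒ (bwd c) (fwd d) t
        with d~w | iter-commute bwd φ′-bwd k c
      ... | inj₁ fwd-d≡φ′ᵏ   | φ′ᵏ≡bwd-σ⁻ᵏ = ⊥-elim (fwd≢bwd (trans fwd-d≡φ′ᵏ φ′ᵏ≡bwd-σ⁻ᵏ))
      ... | inj₂ fwd-d≡α′φ′ᵏ | φ′ᵏ≡bwd-σ⁻ᵏ = σ-Orbit.InOrbit⇒inOrbitᵇ (σ⁻-orbit⊆σ-orbit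
              (suc k , sym (fwd-injective (trans fwd-d≡α′φ′ᵏ (trans (cong α′ φ′ᵏ≡bwd-σ⁻ᵏ) (α′-bwd _))))))

      orbit⇒on-face : ∀ d → T (inOrbitᵇ G σ c d) → T (M′.onFaceᵇ (bwd c) (fwd d))
      orbit⇒on-face d t
        with k , σ⁻ᵏc≡σd ← σ-orbit⊆σ⁻-orbit
                              (σ-Orbit.InOrbit-trans (σ-Orbit.inOrbitᵇ⇒InOrbit c d t) (1 , refl))
        = M′.⇒onFaceᵇ (k , trans (iter-commute bwd φ′-bwd k c) (cong bwd σ⁻ᵏc≡σd))
                      (inj₂ (sym (trans (α′-bwd (σ d)) (cong fwd (σ⁻-σ d))))) (fwd≤α′fwd d)

  module _ (simple : IsSimple G) (σx≢x : ∀ x → σ x ≢ x) where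
    open Simple simple σx≢x

    faceDeg-medial-fwd≡3⇔ : ∀ {c} → faceDeg M (fwd c) ≡ 3 ⇔ faceDeg G (σ c) ≡ 3
    faceDeg-medial-fwd≡3⇔ {c} =
      ⇔.trans (mk⇔ (trans (sym (faceDeg-medial-fwd c))) (trans (faceDeg-medial-fwd c)))
      (⇔.trans ψ-Orbit.orbitSize≡3⇔IsTriangle
      (⇔.trans ψ-IsTriangle⇔φ-IsTriangle (⇔.sym faceDeg≡3⇔IsTriangle)))

    tight-medial⇔ : IsTight M ⇔ (∀ z → (vertexDeg G z ≡ 3) ⊎ (faceDeg G z ≡ 3))
    tight-medial⇔ = mk⇔ corners tight
      where
        corners : IsTight M → ∀ z → (vertexDeg G z ≡ 3) ⊎ (faceDeg G z ≡ 3)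
        corners tight z with tight (fwd (σ⁻ z))
        ... | inj₁ face≡3   = inj₂ (subst (λ w → faceDeg G w ≡ 3) (σ-σ⁻ z)
                                (Equivalence.to faceDeg-medial-fwd≡3⇔ face≡3))
        ... | inj₂ vertex≡3 = inj₁ (subst (λ w → vertexDeg G w ≡ 3) (σ-σ⁻ z)
                                (trans (sym (faceDeg-medial-bwd _))
                                       (subst (λ w → faceDeg M w ≡ 3) (α′-fwd (σ⁻ z)) vertex≡3)))

        tight : (∀ z → (vertexDeg G z ≡ 3) ⊎ (faceDeg G z ≡ 3)) → IsTight M
        tight corners x with dart x
        ... | fwd-dart c with corners (σ c)
        ...   | inj₁ vertex≡3 = inj₂ (subst (λ w → faceDeg M w ≡ 3) (sym (α′-fwd c))
                                  (trans (faceDeg-medial-bwd (σ c)) vertex≡3))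
        ...   | inj₂ face≡3   = inj₁ (Equivalence.from faceDeg-medial-fwd≡3⇔ face≡3)
        tight corners x | bwd-dart c with corners c
        ...   | inj₁ vertex≡3 = inj₁ (trans (faceDeg-medial-bwd c) vertex≡3)
        ...   | inj₂ face≡3   = inj₂ (subst (λ w → faceDeg M w ≡ 3) (sym (α′-bwd c))
                                  (Equivalence.from faceDeg-medial-fwd≡3⇔
                                    (subst (λ w → faceDeg G w ≡ 3) (sym (σ-σ⁻ c)) face≡3)))

  medialVertex-least : ∀ {d y} → toℕ d ≤ toℕ (α d) → y ∈ medialVertex d → toℕ (fwd d) ≤ toℕ y
  medialVertex-least {d} d≤αd (here refl)                         = ≤-refl
  medialVertex-least {d} d≤αd (there (here refl))                 = <⇒≤ (fwd<bwd d d)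
  medialVertex-least {d} d≤αd (there (there (here refl)))         =
    subst₂ _≤_ (sym (toℕ-fwd d)) (sym (toℕ-fwd (α d))) d≤αd
  medialVertex-least {d} d≤αd (there (there (there (here refl)))) = <⇒≤ (fwd<bwd d (α d))

  vertices-medial : numOrbits M σ′ ≡ numOrbits G α
  vertices-medial = begin
    numOrbits M σ′                      ≡⟨ σ′-Orbit.numOrbits≡countFin ⟩
    countFin σ′-Orbit.isLeastᵇ          ≡⟨ countFin-fwd σ′-Orbit.isLeastᵇ bwd-not-least ⟩
    countFin (σ′-Orbit.isLeastᵇ ∘ fwd)  ≡⟨ countFin-cong fwd-least⇒ ⇒fwd-least ⟩
    countFin α-Orbit.isLeastᵇ           ≡⟨ α-Orbit.numOrbits≡countFin ⟨
    numOrbits G α                       ∎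
    where
      open ≡-Reasoning
      module σ′-Orbit = M′.σ-Orbit

      fwd-least⇒ : ∀ d → T (σ′-Orbit.isLeastᵇ (fwd d)) → T (α-Orbit.isLeastᵇ d)
      fwd-least⇒ d t = Equivalence.from (α-isLeastᵇ⇔ d) (subst₂ _≤_ (toℕ-fwd d) (toℕ-fwd (α d))
        (subst (λ z → toℕ (fwd d) ≤ toℕ z) (trans (cong σ′ (σ′-fwd d)) (σ′-bwd d))
               (σ′-Orbit.isLeastᵇ⇒IsLeast (fwd d) t 2)))

      ⇒fwd-least : ∀ d → T (α-Orbit.isLeastᵇ d) → T (σ′-Orbit.isLeastᵇ (fwd d))
      ⇒fwd-least d t = σ′-Orbit.IsLeast⇒isLeastᵇ λ k →
        medialVertex-least (Equivalence.to (α-isLeastᵇ⇔ d) t) (SameVertex-medialVertex (k , refl) (here refl))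

      bwd-not-least : ∀ d → ¬ T (σ′-Orbit.isLeastᵇ (bwd d))
      bwd-not-least d = ¬IsLeastInOrbit (subst (λ z → toℕ z < toℕ (bwd d)) (sym (σ′-bwd d)) (fwd<bwd (α d) d))
                      ∘ σ′-Orbit.isLeastᵇ⇒IsLeast (bwd d)

  edges-medial : numOrbits M α′ ≡ n
  edges-medial = begin
    numOrbits M α′                      ≡⟨ α′-Orbit.numOrbits≡countFin ⟩
    countFin α′-Orbit.isLeastᵇ          ≡⟨ countFin-fwd α′-Orbit.isLeastᵇ bwd-not-least ⟩
    countFin (α′-Orbit.isLeastᵇ ∘ fwd)  ≡⟨ countFin-true fwd-least ⟩
    n                                   ∎
    where
      open ≡-Reasoning
      module α′-Orbit = M′.α-Orbit

      fwd-least : ∀ d → T (α′-Orbit.isLeastᵇ (fwd d))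
      fwd-least d = α′-Orbit.IsLeast⇒isLeastᵇ (IsLeastInOrbit-involution α′-invol (fwd≤α′fwd d))

      bwd-not-least : ∀ d → ¬ T (α′-Orbit.isLeastᵇ (bwd d))
      bwd-not-least d = ¬IsLeastInOrbit (α′bwd<bwd d) ∘ α′-Orbit.isLeastᵇ⇒IsLeast (bwd d)

  faces-medial : numOrbits M φ′ ≡ numOrbits G ψ + numOrbits G σ⁻
  faces-medial = begin
    numOrbits M φ′                                          ≡⟨ φ′-Orbit.numOrbits≡countFin ⟩
    countFin φ′-Orbit.isLeastᵇ                              ≡⟨ countFin-↑ n φ′-Orbit.isLeastᵇ ⟩
    countFin (φ′-Orbit.isLeastᵇ ∘ fwd) + countFin (φ′-Orbit.isLeastᵇ ∘ bwd)
      ≡⟨ cong₂ _+_ (countFin-cong (Equivalence.to ∘ fwd-least⇔) (Equivalence.from ∘ fwd-least⇔))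
                   (countFin-cong (Equivalence.to ∘ bwd-least⇔) (Equivalence.from ∘ bwd-least⇔)) ⟩
    countFin ψ-Orbit.isLeastᵇ + countFin σ⁻-Orbit.isLeastᵇ  ≡⟨ cong₂ _+_ ψ-Orbit.numOrbits≡countFin
                                                                         σ⁻-Orbit.numOrbits≡countFin ⟨
    numOrbits G ψ + numOrbits G σ⁻                          ∎
    where
      open ≡-Reasoning
      module φ′-Orbit = M′.φ-Orbit

      fwd-least⇔ : ∀ d → T (φ′-Orbit.isLeastᵇ (fwd d)) ⇔ T (ψ-Orbit.isLeastᵇ d)
      fwd-least⇔ d = mk⇔
        (ψ-Orbit.IsLeast⇒isLeastᵇ ∘ Equivalence.to shift ∘ φ′-Orbit.isLeastᵇ⇒IsLeast (fwd d))
        (φ′-Orbit.IsLeast⇒isLeastᵇ ∘ Equivalence.from shift ∘ ψ-Orbit.isLeastᵇ⇒IsLeast d)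
        where
          shift : IsLeastInOrbit φ′ (fwd d) ⇔ IsLeastInOrbit ψ d
          shift = IsLeastInOrbit-shift fwd 0 toℕ-fwd φ′-fwd

      bwd-least⇔ : ∀ d → T (φ′-Orbit.isLeastᵇ (bwd d)) ⇔ T (σ⁻-Orbit.isLeastᵇ d)
      bwd-least⇔ d = mk⇔
        (σ⁻-Orbit.IsLeast⇒isLeastᵇ ∘ Equivalence.to shift ∘ φ′-Orbit.isLeastᵇ⇒IsLeast (bwd d))
        (φ′-Orbit.IsLeast⇒isLeastᵇ ∘ Equivalence.from shift ∘ σ⁻-Orbit.isLeastᵇ⇒IsLeast d)
        where
          shift : IsLeastInOrbit φ′ (bwd d) ⇔ IsLeastInOrbit σ⁻ d
          shift = IsLeastInOrbit-shift bwd n toℕ-bwd φ′-bwd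

  planar-medial : Planar G → Planar M
  planar-medial planar = begin
    numOrbits M σ′ + numOrbits M φ′       ≡⟨ cong₂ _+_ vertices-medial faces-medial ⟩
    E + (numOrbits G ψ + numOrbits G σ⁻)  ≡⟨ cong (E +_) (cong₂ _+_ numOrbits-ψ numOrbits-σ⁻) ⟩
    E + (numOrbits G φ + numOrbits G σ)   ≡⟨ cong (E +_) (trans (+-comm (numOrbits G φ) _) planar) ⟩
    E + (2 + E)                           ≡⟨ +-comm E (2 + E) ⟩
    2 + (E + E)                           ≡⟨ cong (2 +_) darts≡edges+edges ⟨
    2 + n                                 ≡⟨ cong (2 +_) edges-medial ⟨
    2 + numOrbits M α′                    ∎
    where
      open ≡-Reasoning
      E : ℕ
      E = numOrbits G α

lemma6 : (G : PreMap) → IsConnectedPlaneGraph G → IsSimple G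
       → (IsLinkGraph (medial G) × IsLuneFree (medial G) × IsTight (medial G)) ⇔ IsSpecial G
lemma6 G (isMap , connected , planar) simple = mk⇔ special link
  where
    open Map G isMap
    open Medial G isMap

    σx≢x : (∀ x → 3 ≤ vertexDeg G x) → ∀ x → PreMap.σ G x ≢ x
    σx≢x 3≤vertexDeg x = proj₁ (Equivalence.to σ-Orbit.3≤orbitSize⇔ (3≤vertexDeg x))

    special : IsLinkGraph M × IsLuneFree M × IsTight M → IsSpecial G
    special (_ , luneFree , tight) =
      connected , 3≤vertexDeg , Simple.3≤faceDeg simple (σx≢x 3≤vertexDeg)
      , Equivalence.from corner-condition⇔ (Equivalence.to (tight-medial⇔ simple (σx≢x 3≤vertexDeg)) tight)
      where
        3≤vertexDeg : ∀ x → 3 ≤ vertexDeg G x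
        3≤vertexDeg = luneFree-medial⇒3≤vertexDeg luneFree

    link : IsSpecial G → IsLinkGraph M × IsLuneFree M × IsTight M
    link (_ , 3≤vertexDeg , _ , corners) =
      ((isMap-medial , connected-medial connected , planar-medial planar) , vertexDeg-medial)
      , (noLoops-medial simple 3≤vertexDeg , noMultipleEdges-medial simple 3≤vertexDeg)
      , Equivalence.from (tight-medial⇔ simple (σx≢x 3≤vertexDeg)) (Equivalence.to corner-condition⇔ corners)
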